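{- Let $d\geq1$, $l\geq 2$ be integers and $0\le i\le dl$. Then $K_{i,d,l}=0$ if $dl-i$ is odd, and otherwise \[K_{i,d,l}=\sum_{j=0}^{\lfloor (dl-i)/(2d+2)\rfloor}(-1)^j\binom{l}{j}\binom{(dl-i)/2-j(d+1)+l-2}{l-2}.\]
   Context: $K_{i,d,l}$ denotes the multiplicity of $\mathrm{Sym}^iV$ in $(\mathrm{Sym}^dV)^{\otimes l}$ for a $2$-dimensional representation $V$; equivalently, when $i\equiv dl\pmod 2$, the Kostka number $K_{\mu,\lambda}$ (number of semistandard tableaux of shape $\mu$ and type $\lambda$) with $\mu=(\frac{dl+i}{2},\frac{dl-i}{2})$ and $\lambda=(d,\dots,d)$ ($l$ entries). -}

module Defs where

open import Data.Bool using (Bool; true; false; _∧_; if_then_else_)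
open import Data.Nat using (ℕ; zero; suc; _+_; _*_; _∸_; _≤ᵇ_; _<ᵇ_; _≡ᵇ_)
open import Data.Fin using (Fin; toℕ)
open import Data.Vec using (Vec; []; _∷_)
open import Data.List using (List; []; _∷_; map; concatMap; filterᵇ; length; allFin; upTo)
open import Data.Nat.ListAction using (sum)
open import Data.Integer using (ℤ; +_; -_)
import Data.Integer as ℤ

-- all vectors of length n with entries in Fin l (entries 0..l-1 stand for 1..l)
vecs : (l n : ℕ) → List (Vec (Fin l) n)
vecs l zero = [] ∷ []
vecs l (suc n) = concatMap (λ x → map (x ∷_) (vecs l n)) (allFin l)

weaklyIncr : ∀ {l n} → Vec (Fin l) n → Bool
weaklyIncr [] = true
weaklyIncr (x ∷ []) = true
weaklyIncr (x ∷ y ∷ xs) = (toℕ x ≤ᵇ toℕ y) ∧ weaklyIncr (y ∷ xs)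

-- columns strictly increasing: row2 lies under (a prefix of) row1
colStrict : ∀ {l a b} → Vec (Fin l) a → Vec (Fin l) b → Bool
colStrict _ [] = true
colStrict [] (_ ∷ _) = false
colStrict (x ∷ xs) (y ∷ ys) = (toℕ x <ᵇ toℕ y) ∧ colStrict xs ys

count : ∀ {l n} → Fin l → Vec (Fin l) n → ℕ
count v [] = 0
count v (x ∷ xs) = (if toℕ x ≡ᵇ toℕ v then 1 else 0) + count v xs

allB : ∀ {A : Set} → (A → Bool) → List A → Bool
allB p [] = true
allB p (x ∷ xs) = p x ∧ allB p xs

isSSYT : ∀ {l a b} → ℕ → Vec (Fin l) a → Vec (Fin l) b → Bool
isSSYT {l} d r1 r2 =
  weaklyIncr r1 ∧ weaklyIncr r2 ∧ colStrict r1 r2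
  ∧ allB (λ v → count v r1 + count v r2 ≡ᵇ d) (allFin l)

kostka2 : (a b d l : ℕ) → ℕ
kostka2 a b d l =
  sum (map (λ r1 → length (filterᵇ (λ r2 → isSSYT d r1 r2) (vecs l b))) (vecs l a))

-- K_{i,d,l}: sum of the Kostka numbers K_{μ,(d^l)} over the two-row partitions
-- μ = (a,b) of d*l with a ≥ b and a - b = i.  There is exactly one such μ,
-- namely ((dl+i)/2,(dl-i)/2), when i ≤ dl and i ≡ dl (mod 2), and none
-- otherwise (so then K = 0, the multiplicity of Sym^i V).
K : (i d l : ℕ) → ℕ
K i d l = sum (map (λ b → let a = d * l ∸ b in
                          if (b ≤ᵇ a) ∧ (a ∸ b ≡ᵇ i) then kostka2 a b d l else 0)
                   (upTo (suc (d * l))))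

Σ≤ : ℕ → (ℕ → ℤ) → ℤ
Σ≤ zero f = f 0
Σ≤ (suc n) f = Σ≤ n f ℤ.+ f (suc n)

sgn : ℕ → ℤ
sgn zero = + 1
sgn (suc j) = - sgn j

{-# OPTIONS --safe #-}
-- Write the entries of a tableau with content (d, …, d) as 0, …, l − 1. The zeros fill a
-- prefix of the first row together with part of the overhang of the second row, so removing
-- them gives a recursion in l for the number of fillings of the skew shape (m + a, b)/(m).
-- By induction this number is N_l(b) − N_l(b − m − 1), where N_l(x) is the coefficient of q^x
-- in (1 + q + ⋯ + q^d)^l: summed over the number t of zeros in the second row, the inductive
-- values telescope through prefix sums of N_l. For m = 0 this is the Kostka number, and
-- N_l(x) − N_l(x − 1) is the coefficient of q^x in (1 − q^(d+1))^l (1 − q)^(−(l−1)), whose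
-- expansion is the stated alternating sum.
module Submission where

open import Data.Nat using (ℕ)

module IntegerSums where
  open import Data.Nat as ℕ using (ℕ; zero; suc; _≤_; _<_; z≤n; s≤s; _⊔_)
  import Data.Nat.Properties as ℕP
  open import Data.Integer using (ℤ; +_; -[1+_]; _+_; _-_; -_)
  import Data.Integer.Properties as ℤP
  open import Data.Integer.Tactic.RingSolver using (solve-∀)
  open import Data.Sum using (inj₁; inj₂)
  open import Function using (_∘_)
  open import Relation.Binary.PropositionalEquality
  open ≡-Reasoning
  open import Defs using (Σ≤)

  Σ≤-cong : ∀ n {f g : ℕ → ℤ} → (∀ j → j ≤ n → f j ≡ g j) → Σ≤ n f ≡ Σ≤ n g
  Σ≤-cong zero    f≡g = f≡g 0 z≤n
  Σ≤-cong (suc n) f≡g =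
    cong₂ _+_ (Σ≤-cong n (λ j j≤n → f≡g j (ℕP.m≤n⇒m≤1+n j≤n))) (f≡g (suc n) ℕP.≤-refl)

  Σ≤-unfoldˡ : ∀ n (f : ℕ → ℤ) → Σ≤ (suc n) f ≡ f 0 + Σ≤ n (f ∘ suc)
  Σ≤-unfoldˡ zero    f = refl
  Σ≤-unfoldˡ (suc n) f = begin
    Σ≤ (suc n) f + f (suc (suc n))           ≡⟨ cong (_+ f (suc (suc n))) (Σ≤-unfoldˡ n f) ⟩
    f 0 + Σ≤ n (f ∘ suc) + f (suc (suc n))   ≡⟨ ℤP.+-assoc (f 0) _ _ ⟩
    f 0 + Σ≤ (suc n) (f ∘ suc)               ∎

  Σ≤-distrib-sub : ∀ n (f g : ℕ → ℤ) → Σ≤ n (λ j → f j - g j) ≡ Σ≤ n f - Σ≤ n g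
  Σ≤-distrib-sub zero    f g = refl
  Σ≤-distrib-sub (suc n) f g = begin
    Σ≤ n (λ j → f j - g j) + (f (suc n) - g (suc n))
      ≡⟨ cong (_+ (f (suc n) - g (suc n))) (Σ≤-distrib-sub n f g) ⟩
    (Σ≤ n f - Σ≤ n g) + (f (suc n) - g (suc n))
      ≡⟨ interchange (Σ≤ n f) (Σ≤ n g) (f (suc n)) (g (suc n)) ⟩
    Σ≤ (suc n) f - Σ≤ (suc n) g ∎
    where
    interchange : ∀ a b c d → (a - b) + (c - d) ≡ (a + c) - (b + d)
    interchange = solve-∀

  Σ≤-zero : ∀ n (f : ℕ → ℤ) → (∀ j → j ≤ n → f j ≡ + 0) → Σ≤ n f ≡ + 0
  Σ≤-zero zero    f f≡0 = f≡0 0 z≤n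
  Σ≤-zero (suc n) f f≡0 =
    cong₂ _+_ (Σ≤-zero n f λ j j≤n → f≡0 j (ℕP.m≤n⇒m≤1+n j≤n)) (f≡0 (suc n) ℕP.≤-refl)

  Σ≤-extend : ∀ {n} M (f : ℕ → ℤ) → n ≤ M → (∀ j → n < j → j ≤ M → f j ≡ + 0) →
              Σ≤ M f ≡ Σ≤ n f
  Σ≤-extend M f n≤M f≡0 with ℕP.m≤n⇒m<n∨m≡n n≤M
  Σ≤-extend M       f n≤M f≡0 | inj₂ refl = refl
  Σ≤-extend {n} (suc M) f n≤M f≡0 | inj₁ (s≤s n≤M') = begin
    Σ≤ M f + f (suc M) ≡⟨ cong₂ _+_ (Σ≤-extend M f n≤M' λ j n<j j≤M → f≡0 j n<j (ℕP.m≤n⇒m≤1+n j≤M))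
                                    (f≡0 (suc M) (s≤s n≤M') ℕP.≤-refl) ⟩
    Σ≤ n f + + 0       ≡⟨ ℤP.+-identityʳ _ ⟩
    Σ≤ n f             ∎

  Σ≤-resize : ∀ m n (f : ℕ → ℤ) → (∀ j → m < j → f j ≡ + 0) → (∀ j → n < j → f j ≡ + 0) →
              Σ≤ m f ≡ Σ≤ n f
  Σ≤-resize m n f vanish-m vanish-n = begin
    Σ≤ m f       ≡⟨ Σ≤-extend (m ⊔ n) f (ℕP.m≤m⊔n m n) (λ j m<j _ → vanish-m j m<j) ⟨
    Σ≤ (m ⊔ n) f ≡⟨ Σ≤-extend (m ⊔ n) f (ℕP.m≤n⊔m m n) (λ j n<j _ → vanish-n j n<j) ⟩
    Σ≤ n f       ∎

  Δ : (ℤ → ℤ) → ℤ → ℤ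
  Δ f x = f x - f (x - + 1)

  Δ-unfold : ∀ (f : ℤ → ℤ) x → f x ≡ Δ f x + f (x - + 1)
  Δ-unfold f x = lemma (f x) (f (x - + 1))
    where
    lemma : ∀ a b → a ≡ (a - b) + b
    lemma = solve-∀

  SupportedOnℕ : (ℤ → ℤ) → Set
  SupportedOnℕ f = ∀ n → f -[1+ n ] ≡ + 0

  supported-< : ∀ {f} → SupportedOnℕ f → ∀ {p q} → p < q → f (+ p - + q) ≡ + 0
  supported-< {f} supp {p} {q} p<q = begin
    f (+ p - + q)   ≡⟨ cong f (trans (ℤP.m-n≡m⊖n p q) (ℤP.⊖-< p<q)) ⟩
    f (- + (q ℕ.∸ p)) ≡⟨ negative (q ℕ.∸ p) (ℕP.m<n⇒0<n∸m p<q) ⟩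
    + 0             ∎
    where
    negative : ∀ n → 0 < n → f (- + n) ≡ + 0
    negative (suc n) _ = supp n

  Δ-injective : ∀ {f g} → SupportedOnℕ f → SupportedOnℕ g → (∀ x → Δ f x ≡ Δ g x) →
                ∀ x → f x ≡ g x
  Δ-injective supp-f supp-g Δf≡Δg -[1+ n ] = trans (supp-f n) (sym (supp-g n))
  Δ-injective {f} {g} supp-f supp-g Δf≡Δg (+ n) = begin
    f (+ n)                     ≡⟨ Δ-unfold f (+ n) ⟩
    Δ f (+ n) + f (+ n - + 1)   ≡⟨ cong₂ _+_ (Δf≡Δg (+ n)) (previous n) ⟩
    Δ g (+ n) + g (+ n - + 1)   ≡⟨ Δ-unfold g (+ n) ⟨
    g (+ n)                     ∎
    where
    previous : ∀ n → f (+ n - + 1) ≡ g (+ n - + 1)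
    previous zero    = Δ-injective {f} {g} supp-f supp-g Δf≡Δg -[1+ 0 ]
    previous (suc n) = Δ-injective {f} {g} supp-f supp-g Δf≡Δg (+ n)

  prefixSum : (ℤ → ℤ) → ℤ → ℤ
  prefixSum f (+ n)    = Σ≤ n (f ∘ +_)
  prefixSum f -[1+ n ] = + 0

  Δ-prefixSum : ∀ {f} → SupportedOnℕ f → ∀ x → Δ (prefixSum f) x ≡ f x
  Δ-prefixSum supp (+ zero)     = ℤP.+-identityʳ _
  Δ-prefixSum {f} supp (+ suc n) = lemma (Σ≤ n (f ∘ +_)) (f (+ suc n))
    where
    lemma : ∀ a b → a + b - a ≡ b
    lemma = solve-∀
  Δ-prefixSum supp -[1+ n ]     = sym (supp n)

  Σ≤-Δ-descending : ∀ (F : ℤ → ℤ) c x → Σ≤ c (λ t → Δ F (x - + t)) ≡ F x - F (x - + suc c)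
  Σ≤-Δ-descending F zero    x = cong (λ y → F y - F (y - + 1)) (ℤP.+-identityʳ x)
  Σ≤-Δ-descending F (suc c) x = begin
    Σ≤ c (λ t → Δ F (x - + t)) + Δ F (x - + suc c)
      ≡⟨ cong (_+ Δ F (x - + suc c)) (Σ≤-Δ-descending F c x) ⟩
    (F x - F (x - + suc c)) + (F (x - + suc c) - F (x - + suc c - + 1))
      ≡⟨ cancel (F x) (F (x - + suc c)) _ ⟩
    F x - F (x - + suc c - + 1)
      ≡⟨ cong (λ y → F x - F y) (shift x (+ suc c)) ⟩
    F x - F (x - + suc (suc c)) ∎
    where
    cancel : ∀ a b c → (a - b) + (b - c) ≡ a - c
    cancel = solve-∀
    shift : ∀ x y → x - y - + 1 ≡ x - (+ 1 + y)
    shift = solve-∀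

  Σ≤-Δ-ascending : ∀ (F : ℤ → ℤ) c y → Σ≤ c (λ t → Δ F (y + + t)) ≡ F (y + + c) - F (y - + 1)
  Σ≤-Δ-ascending F zero    y = cong (λ x → F (y + + 0) - F (x - + 1)) (ℤP.+-identityʳ y)
  Σ≤-Δ-ascending F (suc c) y = begin
    Σ≤ c (λ t → Δ F (y + + t)) + Δ F (y + + suc c)
      ≡⟨ cong (_+ Δ F (y + + suc c)) (Σ≤-Δ-ascending F c y) ⟩
    (F (y + + c) - F (y - + 1)) + (F (y + + suc c) - F (y + + suc c - + 1))
      ≡⟨ cong (λ x → (F (y + + c) - F (y - + 1)) + (F (y + + suc c) - F x)) (shift y (+ c)) ⟩
    (F (y + + c) - F (y - + 1)) + (F (y + + suc c) - F (y + + c))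
      ≡⟨ cancel (F (y + + c)) (F (y - + 1)) (F (y + + suc c)) ⟩
    F (y + + suc c) - F (y - + 1) ∎
    where
    cancel : ∀ a b c → (a - b) + (c - a) ≡ c - b
    cancel = solve-∀
    shift : ∀ y c → y + (+ 1 + c) - + 1 ≡ y + c
    shift = solve-∀

  m-n≡m∸n : ∀ {m n} → n ≤ m → + m - + n ≡ + (m ℕ.∸ n)
  m-n≡m∸n {m} {n} n≤m = trans (ℤP.m-n≡m⊖n m n) (ℤP.⊖-≥ n≤m)

  supported-shift : ∀ {f} → SupportedOnℕ f → ∀ k → SupportedOnℕ (λ x → f (x - + k))
  supported-shift {f} supp k n = begin
    f (-[1+ n ] - + k)   ≡⟨ cong f (shift n k) ⟩
    f -[1+ n ℕ.+ k ]     ≡⟨ supp (n ℕ.+ k) ⟩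
    + 0                  ∎
    where
    shift : ∀ n k → -[1+ n ] - + k ≡ -[1+ n ℕ.+ k ]
    shift n zero    = cong -[1+_] (sym (ℕP.+-identityʳ n))
    shift n (suc k) = cong -[1+_] (sym (ℕP.+-suc n k))

  Σ≤-downward : ∀ {f} → SupportedOnℕ f → ∀ c x →
                Σ≤ c (λ t → f (x - + t)) ≡ prefixSum f x - prefixSum f (x - + suc c)
  Σ≤-downward {f} supp c x =
    trans (Σ≤-cong c λ t _ → sym (Δ-prefixSum supp (x - + t))) (Σ≤-Δ-descending (prefixSum f) c x)

  Σ≤-upward : ∀ {f} → SupportedOnℕ f → ∀ c y →
              Σ≤ c (λ t → f (y + + t)) ≡ prefixSum f (y + + c) - prefixSum f (y - + 1)
  Σ≤-upward {f} supp c y =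
    trans (Σ≤-cong c λ t _ → sym (Δ-prefixSum supp (y + + t))) (Σ≤-Δ-ascending (prefixSum f) c y)

  Σ≤-truncate : ∀ b c (F h : ℕ → ℤ) →
                (∀ t → t ≤ b → t ≤ c → F t ≡ h t) → (∀ t → t ≤ b → c < t → F t ≡ + 0) →
                (∀ t → b < t → t ≤ c → h t ≡ + 0) → Σ≤ b F ≡ Σ≤ c h
  Σ≤-truncate b c F h F≡h F≡0 h≡0 with ℕP.≤-total c b
  ... | inj₁ c≤b = begin
    Σ≤ b F ≡⟨ Σ≤-extend b F c≤b (λ t c<t t≤b → F≡0 t t≤b c<t) ⟩
    Σ≤ c F ≡⟨ Σ≤-cong c (λ t t≤c → F≡h t (ℕP.≤-trans t≤c c≤b) t≤c) ⟩
    Σ≤ c h ∎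
  ... | inj₂ b≤c = begin
    Σ≤ b F ≡⟨ Σ≤-cong b (λ t t≤b → F≡h t t≤b (ℕP.≤-trans t≤b b≤c)) ⟩
    Σ≤ b h ≡⟨ Σ≤-extend c h b≤c h≡0 ⟨
    Σ≤ c h ∎

module Coefficients (d : ℕ) where
  open import Data.Nat as ℕ using (ℕ; zero; suc; _≤_; _<_; _∸_; _/_)
  import Data.Nat.Properties as ℕP
  open import Data.Nat.DivMod using (m/n*n≤m; m*n/n≡m; /-monoˡ-≤)
  open import Data.Nat.Combinatorics using (_C_; nCn≡1; nCk+nC[k+1]≡[n+1]C[k+1])
  open import Data.Nat.Combinatorics.Specification using (k>n⇒nCk≡0)
  open import Data.Integer using (ℤ; +_; -[1+_]; _+_; _-_; -_; _*_)
  import Data.Integer.Properties as ℤP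
  open import Data.Integer.Tactic.RingSolver using (solve-∀)
  open import Function using (_∘_)
  open import Relation.Nullary using (contradiction)
  open import Relation.Binary.PropositionalEquality
  open ≡-Reasoning
  open import Defs using (Σ≤; sgn)
  open IntegerSums

  δ : ℤ → ℤ
  δ (+ zero) = + 1
  δ _        = + 0

  -- The coefficient of q^x in (1 - q)^(-m).
  multichoose : ℕ → ℤ → ℤ
  multichoose zero    x        = δ x
  multichoose (suc m) (+ n)    = + ((n ℕ.+ m) C m)
  multichoose (suc m) -[1+ n ] = + 0

  -- The coefficient of q^x in (1 - q^(d+1))^l (1 - q)^(-m).
  ratioCoeff : ℕ → ℕ → ℤ → ℤ
  ratioCoeff l m x = Σ≤ l (λ j → sgn j * + (l C j) * multichoose m (x - + (j ℕ.* suc d)))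

  -- Multiplication by 1 + q + ⋯ + q^d.
  window : (ℤ → ℤ) → ℤ → ℤ
  window f x = Σ≤ d (λ t → f (x - + t))

  -- The coefficient of q^x in (1 + q + ⋯ + q^d)^l: the number of ways to write x
  -- as an ordered sum of l numbers from [0, d].
  compositions : ℕ → ℤ → ℤ
  compositions zero    = δ
  compositions (suc l) = window (compositions l)

  multichoose-supported : ∀ m → SupportedOnℕ (multichoose m)
  multichoose-supported zero    n = refl
  multichoose-supported (suc m) n = refl

  ratioCoeff-supported : ∀ l m → SupportedOnℕ (ratioCoeff l m)
  ratioCoeff-supported l m n = Σ≤-zero l _ λ j _ → begin
    sgn j * + (l C j) * multichoose m (-[1+ n ] - + (j ℕ.* suc d))
      ≡⟨ cong (sgn j * + (l C j) *_) (supported-shift {multichoose m} (multichoose-supported m) (j ℕ.* suc d) n) ⟩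
    sgn j * + (l C j) * + 0
      ≡⟨ ℤP.*-zeroʳ (sgn j * + (l C j)) ⟩
    + 0 ∎

  compositions-supported : ∀ l → SupportedOnℕ (compositions l)
  compositions-supported zero    n = refl
  compositions-supported (suc l) n =
    Σ≤-zero d _ λ t _ → supported-shift {compositions l} (compositions-supported l) t n

  Δ-multichoose : ∀ m x → Δ (multichoose (suc m)) x ≡ multichoose m x
  Δ-multichoose zero    (+ zero)  = refl
  Δ-multichoose (suc m) (+ zero)  = cong +_ (trans (ℕP.+-identityʳ _) (trans (nCn≡1 (suc m)) (sym (nCn≡1 m))))
  Δ-multichoose zero    (+ suc n) = refl
  Δ-multichoose (suc m) (+ suc n) = begin
    + (suc (n ℕ.+ suc m) C suc m) - + ((n ℕ.+ suc m) C suc m)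
      ≡⟨ cong (λ c → + c - + ((n ℕ.+ suc m) C suc m)) (nCk+nC[k+1]≡[n+1]C[k+1] (n ℕ.+ suc m) m) ⟨
    + ((n ℕ.+ suc m) C m) + + ((n ℕ.+ suc m) C suc m) - + ((n ℕ.+ suc m) C suc m)
      ≡⟨ cancel (+ ((n ℕ.+ suc m) C m)) (+ ((n ℕ.+ suc m) C suc m)) ⟩
    + ((n ℕ.+ suc m) C m)
      ≡⟨ cong (λ k → + (k C m)) (ℕP.+-suc n m) ⟩
    + ((suc n ℕ.+ m) C m) ∎
    where
    cancel : ∀ a b → a + b - b ≡ a
    cancel = solve-∀
  Δ-multichoose zero    -[1+ n ] = refl
  Δ-multichoose (suc m) -[1+ n ] = refl

  Δ-ratioCoeff : ∀ l m x → Δ (ratioCoeff l (suc m)) x ≡ ratioCoeff l m x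
  Δ-ratioCoeff l m x = begin
    Δ (ratioCoeff l (suc m)) x
      ≡⟨ Σ≤-distrib-sub l _ _ ⟨
    Σ≤ l (λ j → c j * M (x - + (j ℕ.* suc d)) - c j * M (x - + 1 - + (j ℕ.* suc d)))
      ≡⟨ Σ≤-cong l (λ j _ → begin
           c j * M (x - + (j ℕ.* suc d)) - c j * M (x - + 1 - + (j ℕ.* suc d))
             ≡⟨ cong (λ y → c j * M (x - + (j ℕ.* suc d)) - c j * M y) (swap x (+ (j ℕ.* suc d))) ⟩
           c j * M (x - + (j ℕ.* suc d)) - c j * M (x - + (j ℕ.* suc d) - + 1)
             ≡⟨ factor (c j) _ _ ⟩
           c j * Δ M (x - + (j ℕ.* suc d))
             ≡⟨ cong (c j *_) (Δ-multichoose m _) ⟩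
           c j * multichoose m (x - + (j ℕ.* suc d)) ∎) ⟩
    ratioCoeff l m x ∎
    where
    M : ℤ → ℤ
    M = multichoose (suc m)
    c : ℕ → ℤ
    c j = sgn j * + (l C j)
    swap : ∀ x y → x - + 1 - y ≡ x - y - + 1
    swap = solve-∀
    factor : ∀ c u v → c * u - c * v ≡ c * (u - v)
    factor = solve-∀

  signedBinomial-vanishes : ∀ {l j} → l < j → ∀ y → sgn j * + (l C j) * y ≡ + 0
  signedBinomial-vanishes {l} {j} l<j y = begin
    sgn j * + (l C j) * y ≡⟨ cong (λ c → sgn j * + c * y) (k>n⇒nCk≡0 l<j) ⟩
    sgn j * + 0 * y       ≡⟨ zero-middle (sgn j) y ⟩
    + 0                   ∎
    where
    zero-middle : ∀ a b → a * + 0 * b ≡ + 0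
    zero-middle = solve-∀

  ratioCoeff-suc : ∀ l m x → ratioCoeff (suc l) m x ≡ ratioCoeff l m x - ratioCoeff l m (x - + suc d)
  ratioCoeff-suc l m x = begin
    ratioCoeff (suc l) m x
      ≡⟨ Σ≤-unfoldˡ l _ ⟩
    term x 0 + Σ≤ l (λ j → sgn (suc j) * + (suc l C suc j) * M (x - + (suc j ℕ.* suc d)))
      ≡⟨ cong (λ s → term x 0 + s) (Σ≤-cong l λ j _ → pascal j) ⟩
    term x 0 + Σ≤ l (λ j → term x (suc j) - term (x - + suc d) j)
      ≡⟨ cong (λ s → term x 0 + s) (Σ≤-distrib-sub l _ _) ⟩
    term x 0 + (Σ≤ l (term x ∘ suc) - ratioCoeff l m (x - + suc d))
      ≡⟨ ℤP.+-assoc (term x 0) _ _ ⟨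
    term x 0 + Σ≤ l (term x ∘ suc) - ratioCoeff l m (x - + suc d)
      ≡⟨ cong (_- ratioCoeff l m (x - + suc d)) (Σ≤-unfoldˡ l (term x)) ⟨
    Σ≤ (suc l) (term x) - ratioCoeff l m (x - + suc d)
      ≡⟨ cong (_- ratioCoeff l m (x - + suc d)) (Σ≤-extend (suc l) (term x) (ℕP.n≤1+n l) beyond-l) ⟩
    ratioCoeff l m x - ratioCoeff l m (x - + suc d) ∎
    where
    M : ℤ → ℤ
    M = multichoose m
    term : ℤ → ℕ → ℤ
    term y j = sgn j * + (l C j) * M (y - + (j ℕ.* suc d))

    beyond-l : ∀ j → l < j → j ≤ suc l → term x j ≡ + 0
    beyond-l j l<j _ = signedBinomial-vanishes l<j _

    pascal : ∀ j → sgn (suc j) * + (suc l C suc j) * M (x - + (suc j ℕ.* suc d))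
                   ≡ term x (suc j) - term (x - + suc d) j
    pascal j = begin
      - sgn j * + (suc l C suc j) * M (x - + (suc j ℕ.* suc d))
        ≡⟨ cong (λ c → - sgn j * + c * M (x - + (suc j ℕ.* suc d))) (nCk+nC[k+1]≡[n+1]C[k+1] l j) ⟨
      - sgn j * (+ (l C j) + + (l C suc j)) * M (x - + (suc j ℕ.* suc d))
        ≡⟨ distrib (sgn j) (+ (l C j)) (+ (l C suc j)) _ ⟩
      - sgn j * + (l C suc j) * M (x - + (suc j ℕ.* suc d)) - sgn j * + (l C j) * M (x - + (suc j ℕ.* suc d))
        ≡⟨ cong (λ y → term x (suc j) - sgn j * + (l C j) * M y) (shift x (+ suc d) (+ (j ℕ.* suc d))) ⟩
      term x (suc j) - term (x - + suc d) j ∎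
      where
      distrib : ∀ s p q b → - s * (p + q) * b ≡ - s * q * b - s * p * b
      distrib = solve-∀
      shift : ∀ x a b → x - (a + b) ≡ x - a - b
      shift = solve-∀

  Δ-window : ∀ (f : ℤ → ℤ) x → Δ (window f) x ≡ f x - f (x - + suc d)
  Δ-window f x = begin
    W x - W (x - + 1)                            ≡⟨ regroup (W x) (f (x - + suc d)) (W (x - + 1)) ⟩
    (W x + f (x - + suc d)) - (W (x - + 1) + f (x - + suc d))
                                                 ≡⟨ cong (_- (W (x - + 1) + f (x - + suc d))) slide ⟩
    (f x + W (x - + 1)) - (W (x - + 1) + f (x - + suc d))
                                                 ≡⟨ cancel (f x) (W (x - + 1)) (f (x - + suc d)) ⟩
    f x - f (x - + suc d)                        ∎
    where
    W : ℤ → ℤ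
    W = window f
    slide : W x + f (x - + suc d) ≡ f x + W (x - + 1)
    slide = trans (Σ≤-unfoldˡ d (λ t → f (x - + t)))
                  (cong₂ _+_ (cong f (ℤP.+-identityʳ x)) (Σ≤-cong d λ t _ → cong f (shift x (+ t))))
      where
      shift : ∀ x t → x - (+ 1 + t) ≡ x - + 1 - t
      shift = solve-∀
    regroup : ∀ a b c → a - c ≡ (a + b) - (c + b)
    regroup = solve-∀
    cancel : ∀ a b c → (a + b) - (b + c) ≡ a - c
    cancel = solve-∀

  compositions≡ratioCoeff : ∀ l x → compositions l x ≡ ratioCoeff l l x
  compositions≡ratioCoeff zero    x = sym (trans (ℤP.*-identityˡ _) (cong δ (ℤP.+-identityʳ x)))
  compositions≡ratioCoeff (suc l) =
    Δ-injective {compositions (suc l)} {ratioCoeff (suc l) (suc l)}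
      (compositions-supported (suc l)) (ratioCoeff-supported (suc l) (suc l)) λ x → begin
      Δ (compositions (suc l)) x                        ≡⟨ Δ-window (compositions l) x ⟩
      compositions l x - compositions l (x - + suc d)   ≡⟨ cong₂ _-_ (compositions≡ratioCoeff l x)
                                                                   (compositions≡ratioCoeff l (x - + suc d)) ⟩
      ratioCoeff l l x - ratioCoeff l l (x - + suc d)   ≡⟨ ratioCoeff-suc l l x ⟨
      ratioCoeff (suc l) l x                            ≡⟨ Δ-ratioCoeff (suc l) l x ⟨
      Δ (ratioCoeff (suc l) (suc l)) x                  ∎

  Δ-compositions : ∀ l x → Δ (compositions (suc l)) x ≡ ratioCoeff (suc l) l x
  Δ-compositions l x = begin
    Δ (compositions (suc l)) x       ≡⟨ cong₂ _-_ (compositions≡ratioCoeff (suc l) x)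
                                                  (compositions≡ratioCoeff (suc l) (x - + 1)) ⟩
    Δ (ratioCoeff (suc l) (suc l)) x ≡⟨ Δ-ratioCoeff (suc l) l x ⟩
    ratioCoeff (suc l) l x           ∎

  compositions-above : ∀ l n → d ℕ.* l < n → compositions l (+ n) ≡ + 0
  compositions-above zero    zero    dl<n = contradiction (subst (_< 0) (ℕP.*-zeroʳ d) dl<n) (λ ())
  compositions-above zero    (suc n) dl<n = refl
  compositions-above (suc l) n       dl<n = Σ≤-zero d _ λ t t≤d → begin
    compositions l (+ n - + t)   ≡⟨ cong (compositions l) (m-n≡m∸n (ℕP.≤-trans (ℕP.m≤n+m t _) (bound t≤d))) ⟩
    compositions l (+ (n ∸ t))   ≡⟨ compositions-above l (n ∸ t)
                                      (ℕP.m+n≤o⇒m≤o∸n (suc (d ℕ.* l)) (bound t≤d)) ⟩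
    + 0                          ∎
    where
    bound : ∀ {t} → t ≤ d → suc (d ℕ.* l) ℕ.+ t ≤ n
    bound {t} t≤d = ℕP.≤-trans (ℕP.+-monoʳ-≤ (suc (d ℕ.* l)) t≤d)
      (subst (λ k → suc k ≤ n) (trans (ℕP.*-suc d l) (ℕP.+-comm d (d ℕ.* l))) dl<n)

  ratioCoeff-closedForm : ∀ l m s → ratioCoeff l (suc m) (+ s) ≡
    Σ≤ (s / suc d) (λ j → sgn j * + (l C j) * + ((s ∸ j ℕ.* suc d ℕ.+ m) C m))
  ratioCoeff-closedForm l m s = begin
    ratioCoeff l (suc m) (+ s)
      ≡⟨ Σ≤-resize l (s / suc d) term (λ j l<j → signedBinomial-vanishes l<j _) beyond-s ⟩
    Σ≤ (s / suc d) term
      ≡⟨ Σ≤-cong (s / suc d) (λ j j≤s/e → cong (sgn j * + (l C j) *_) (in-range j≤s/e)) ⟩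
    Σ≤ (s / suc d) (λ j → sgn j * + (l C j) * + ((s ∸ j ℕ.* suc d ℕ.+ m) C m)) ∎
    where
    term : ℕ → ℤ
    term j = sgn j * + (l C j) * multichoose (suc m) (+ s - + (j ℕ.* suc d))

    beyond-s : ∀ j → s / suc d < j → term j ≡ + 0
    beyond-s j s/e<j = begin
      term j                        ≡⟨ cong (sgn j * + (l C j) *_)
                                         (supported-< {multichoose (suc m)} (multichoose-supported (suc m)) s<je) ⟩
      sgn j * + (l C j) * + 0       ≡⟨ ℤP.*-zeroʳ (sgn j * + (l C j)) ⟩
      + 0                           ∎
      where
      s<je : s < j ℕ.* suc d
      s<je = ℕP.≰⇒> λ je≤s → ℕP.<⇒≱ s/e<j
        (subst (_≤ s / suc d) (m*n/n≡m j (suc d)) (/-monoˡ-≤ (suc d) je≤s))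

    in-range : ∀ {j} → j ≤ s / suc d →
               multichoose (suc m) (+ s - + (j ℕ.* suc d)) ≡ + ((s ∸ j ℕ.* suc d ℕ.+ m) C m)
    in-range {j} j≤s/e =
      cong (multichoose (suc m)) (m-n≡m∸n (ℕP.≤-trans (ℕP.*-monoˡ-≤ (suc d) j≤s/e) (m/n*n≤m s (suc d))))

module NatSums where
  open import Data.Bool using (Bool; true; false; if_then_else_)
  open import Data.Nat using (ℕ; zero; suc; _+_; _≤_; z≤n; s≤s)
  import Data.Nat.Properties as ℕP
  open import Algebra.Properties.CommutativeSemigroup ℕP.+-commutativeSemigroup
    using () renaming (interchange to +-interchange)
  open import Data.List using (List; []; _∷_; _++_; map; concatMap; applyUpTo)
  open import Data.Nat.ListAction using (sum)
  open import Function using (_∘_)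
  open import Relation.Nullary using (¬_; contradiction)
  open import Relation.Binary.PropositionalEquality

  when : Bool → ℕ → ℕ
  when b n = if b then n else 0

  when-false : ∀ {b} n → ¬ b ≡ true → when b n ≡ 0
  when-false {false} n _     = refl
  when-false {true}  n ¬true = contradiction refl ¬true

  when-swap : ∀ p q n → when p (when q n) ≡ when q (when p n)
  when-swap false false n = refl
  when-swap false true  n = refl
  when-swap true  false n = refl
  when-swap true  true  n = refl

  sumOver : ∀ {A : Set} → List A → (A → ℕ) → ℕ
  sumOver []       f = 0
  sumOver (x ∷ xs) f = f x + sumOver xs f

  sumOver-cong : ∀ {A : Set} (xs : List A) {f g : A → ℕ} → (∀ x → f x ≡ g x) → sumOver xs f ≡ sumOver xs g
  sumOver-cong []       f≡g = refl
  sumOver-cong (x ∷ xs) f≡g = cong₂ _+_ (f≡g x) (sumOver-cong xs f≡g)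

  sumOver-zero : ∀ {A : Set} (xs : List A) {f : A → ℕ} → (∀ x → f x ≡ 0) → sumOver xs f ≡ 0
  sumOver-zero []       f≡0 = refl
  sumOver-zero (x ∷ xs) f≡0 = cong₂ _+_ (f≡0 x) (sumOver-zero xs f≡0)

  sumOver-++ : ∀ {A : Set} (xs ys : List A) f → sumOver (xs ++ ys) f ≡ sumOver xs f + sumOver ys f
  sumOver-++ []       ys f = refl
  sumOver-++ (x ∷ xs) ys f = trans (cong (f x +_) (sumOver-++ xs ys f)) (sym (ℕP.+-assoc (f x) _ _))

  sumOver-map : ∀ {A B : Set} (g : A → B) (xs : List A) f → sumOver (map g xs) f ≡ sumOver xs (f ∘ g)
  sumOver-map g []       f = refl
  sumOver-map g (x ∷ xs) f = cong (f (g x) +_) (sumOver-map g xs f)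

  sumOver-concatMap : ∀ {A B : Set} (g : A → List B) (xs : List A) f →
                      sumOver (concatMap g xs) f ≡ sumOver xs (λ x → sumOver (g x) f)
  sumOver-concatMap g []       f = refl
  sumOver-concatMap g (x ∷ xs) f =
    trans (sumOver-++ (g x) _ f) (cong (sumOver (g x) f +_) (sumOver-concatMap g xs f))

  sum-map : ∀ {A : Set} (f : A → ℕ) xs → sum (map f xs) ≡ sumOver xs f
  sum-map f []       = refl
  sum-map f (x ∷ xs) = cong (f x +_) (sum-map f xs)

  sumOver-when : ∀ {A : Set} (xs : List A) b f → sumOver xs (λ x → when b (f x)) ≡ when b (sumOver xs f)
  sumOver-when xs true  f = refl
  sumOver-when xs false f = sumOver-zero xs (λ _ → refl)

  Σℕ≤ : ℕ → (ℕ → ℕ) → ℕ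
  Σℕ≤ zero    f = f 0
  Σℕ≤ (suc n) f = f 0 + Σℕ≤ n (f ∘ suc)

  sumOver-applyUpTo : ∀ (g : ℕ → ℕ) n f → sumOver (applyUpTo g (suc n)) f ≡ Σℕ≤ n (f ∘ g)
  sumOver-applyUpTo g zero    f = ℕP.+-identityʳ _
  sumOver-applyUpTo g (suc n) f = cong (f (g 0) +_) (sumOver-applyUpTo (g ∘ suc) n f)

  Σℕ≤-cong : ∀ n {f g : ℕ → ℕ} → (∀ k → k ≤ n → f k ≡ g k) → Σℕ≤ n f ≡ Σℕ≤ n g
  Σℕ≤-cong zero    f≡g = f≡g 0 z≤n
  Σℕ≤-cong (suc n) f≡g = cong₂ _+_ (f≡g 0 z≤n) (Σℕ≤-cong n (λ k k≤n → f≡g (suc k) (s≤s k≤n)))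

  Σℕ≤-zero : ∀ n {f : ℕ → ℕ} → (∀ k → k ≤ n → f k ≡ 0) → Σℕ≤ n f ≡ 0
  Σℕ≤-zero zero    f≡0 = f≡0 0 z≤n
  Σℕ≤-zero (suc n) f≡0 = cong₂ _+_ (f≡0 0 z≤n) (Σℕ≤-zero n (λ k k≤n → f≡0 (suc k) (s≤s k≤n)))

  Σℕ≤-single : ∀ n {c} {f : ℕ → ℕ} → c ≤ n → (∀ k → ¬ k ≡ c → f k ≡ 0) → Σℕ≤ n f ≡ f c
  Σℕ≤-single zero    {zero}  z≤n         f≡0 = refl
  Σℕ≤-single (suc n) {zero}  c≤n         f≡0 =
    trans (cong (_ +_) (Σℕ≤-zero n (λ k _ → f≡0 (suc k) (λ ())))) (ℕP.+-identityʳ _)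
  Σℕ≤-single (suc n) {suc c} (s≤s c≤n) f≡0 =
    cong₂ _+_ (f≡0 0 (λ ())) (Σℕ≤-single n c≤n (λ k k≢c → f≡0 (suc k) (k≢c ∘ ℕP.suc-injective)))

  Σℕ≤-distrib-+ : ∀ n (f g : ℕ → ℕ) → Σℕ≤ n (λ k → f k + g k) ≡ Σℕ≤ n f + Σℕ≤ n g
  Σℕ≤-distrib-+ zero    f g = refl
  Σℕ≤-distrib-+ (suc n) f g =
    trans (cong (f 0 + g 0 +_) (Σℕ≤-distrib-+ n _ _)) (+-interchange (f 0) (g 0) _ _)

  Σℕ≤-when : ∀ n b (f : ℕ → ℕ) → when b (Σℕ≤ n f) ≡ Σℕ≤ n (λ k → when b (f k))
  Σℕ≤-when n true  f = refl
  Σℕ≤-when n false f = sym (Σℕ≤-zero n (λ _ _ → refl))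

  Σℕ≤-comm : ∀ a b (h : ℕ → ℕ → ℕ) →
             Σℕ≤ a (λ k → Σℕ≤ b (h k)) ≡ Σℕ≤ b (λ t → Σℕ≤ a (λ k → h k t))
  Σℕ≤-comm zero    b h = refl
  Σℕ≤-comm (suc a) b h =
    trans (cong (Σℕ≤ b (h 0) +_) (Σℕ≤-comm a b (h ∘ suc))) (sym (Σℕ≤-distrib-+ b _ _))

  sumOver-Σℕ≤-comm : ∀ {A : Set} (xs : List A) n (g : A → ℕ → ℕ) →
                     sumOver xs (λ x → Σℕ≤ n (g x)) ≡ Σℕ≤ n (λ t → sumOver xs (λ x → g x t))
  sumOver-Σℕ≤-comm []       n g = sym (Σℕ≤-zero n (λ _ _ → refl))
  sumOver-Σℕ≤-comm (x ∷ xs) n g =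
    trans (cong (Σℕ≤ n (g x) +_) (sumOver-Σℕ≤-comm xs n g)) (sym (Σℕ≤-distrib-+ n (g x) _))


module IncreasingVectors where
  open import Data.Bool using (true; false)
  open import Data.Nat using (ℕ; zero; suc; _+_; _∸_; _≤ᵇ_)
  import Data.Nat.Properties as ℕP
  open import Data.Fin using (Fin; zero; suc; toℕ)
  open import Data.Vec using (Vec; []; _∷_; map)
  open import Data.List as List using (allFin)
  open import Data.List.Properties using (map-tabulate)
  open import Function using (id; _∘_)
  open import Relation.Binary.PropositionalEquality
  open ≡-Reasoning
  open import Defs using (vecs; weaklyIncr)
  open NatSums

  suc-≤ᵇ-suc : ∀ a b → (suc a ≤ᵇ suc b) ≡ (a ≤ᵇ b)
  suc-≤ᵇ-suc zero    b = refl
  suc-≤ᵇ-suc (suc a) b = refl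

  sumOver-allFin-suc : ∀ l (g : Fin (suc l) → ℕ) → sumOver (allFin (suc l)) g ≡ g zero + sumOver (allFin l) (g ∘ suc)
  sumOver-allFin-suc l g = cong (g zero +_) (begin
    sumOver (List.tabulate suc) g          ≡⟨ cong (λ xs → sumOver xs g) (map-tabulate id suc) ⟨
    sumOver (List.map suc (allFin l)) g    ≡⟨ sumOver-map suc (allFin l) g ⟩
    sumOver (allFin l) (g ∘ suc)           ∎)

  sumOver-vecs-suc : ∀ l n (f : Vec (Fin l) (suc n) → ℕ) →
                     sumOver (vecs l (suc n)) f ≡ sumOver (allFin l) (λ x → sumOver (vecs l n) (f ∘ (x ∷_)))
  sumOver-vecs-suc l n f =
    trans (sumOver-concatMap _ (allFin l) f) (sumOver-cong (allFin l) (λ x → sumOver-map (x ∷_) (vecs l n) f))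

  sumIncr : ∀ l n → (Vec (Fin l) n → ℕ) → ℕ
  sumIncr l n f = sumOver (vecs l n) (λ r → when (weaklyIncr r) (f r))

  sumIncr-cong : ∀ l n {f g : Vec (Fin l) n → ℕ} → (∀ r → f r ≡ g r) → sumIncr l n f ≡ sumIncr l n g
  sumIncr-cong l n f≡g = sumOver-cong (vecs l n) (λ r → cong (when (weaklyIncr r)) (f≡g r))

  sumIncr-when : ∀ l n b (f : Vec (Fin l) n → ℕ) → sumIncr l n (λ r → when b (f r)) ≡ when b (sumIncr l n f)
  sumIncr-when l n b f =
    trans (sumOver-cong (vecs l n) (λ r → when-swap (weaklyIncr r) b (f r))) (sumOver-when (vecs l n) b _)

  sumIncr-Σℕ≤-comm : ∀ l n b (g : Vec (Fin l) n → ℕ → ℕ) →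
                     sumIncr l n (λ r → Σℕ≤ b (g r)) ≡ Σℕ≤ b (λ t → sumIncr l n (λ r → g r t))
  sumIncr-Σℕ≤-comm l n b g =
    trans (sumOver-cong (vecs l n) (λ r → Σℕ≤-when b (weaklyIncr r) (g r))) (sumOver-Σℕ≤-comm (vecs l n) b _)

  weaklyIncr-zero∷ : ∀ {l n} (r : Vec (Fin (suc l)) n) → weaklyIncr (zero ∷ r) ≡ weaklyIncr r
  weaklyIncr-zero∷ []      = refl
  weaklyIncr-zero∷ (y ∷ r) = refl

  -- An increasing vector that follows a nonzero entry contains no zero.
  sumOver-after-suc : ∀ l n (x : Fin l) (g : Vec (Fin (suc l)) n → ℕ) →
    sumOver (vecs (suc l) n) (λ r → when (weaklyIncr (suc x ∷ r)) (g r)) ≡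
    sumOver (vecs l n) (λ r → when (weaklyIncr (x ∷ r)) (g (map suc r)))
  sumOver-after-suc l zero    x g = refl
  sumOver-after-suc l (suc n) x g = begin
    sumOver (vecs (suc l) (suc n)) (λ r → when (weaklyIncr (suc x ∷ r)) (g r))
      ≡⟨ sumOver-vecs-suc (suc l) n _ ⟩
    sumOver (allFin (suc l)) (λ y → sumOver (vecs (suc l) n) (λ r → when (weaklyIncr (suc x ∷ y ∷ r)) (g (y ∷ r))))
      ≡⟨ sumOver-allFin-suc l _ ⟩
    sumOver (vecs (suc l) n) (λ r → when false (g (zero ∷ r))) +
    sumOver (allFin l) (λ y → sumOver (vecs (suc l) n) (λ r → when (weaklyIncr (suc x ∷ suc y ∷ r)) (g (suc y ∷ r))))
      ≡⟨ cong₂ _+_ (sumOver-zero (vecs (suc l) n) (λ _ → refl)) (sumOver-cong (allFin l) after) ⟩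
    0 + sumOver (allFin l) (λ y → sumOver (vecs l n) (λ r → when (weaklyIncr (x ∷ y ∷ r)) (g (map suc (y ∷ r)))))
      ≡⟨ sumOver-vecs-suc l n _ ⟨
    sumOver (vecs l (suc n)) (λ r → when (weaklyIncr (x ∷ r)) (g (map suc r))) ∎
    where
    after : ∀ y → sumOver (vecs (suc l) n) (λ r → when (weaklyIncr (suc x ∷ suc y ∷ r)) (g (suc y ∷ r)))
                ≡ sumOver (vecs l n) (λ r → when (weaklyIncr (x ∷ y ∷ r)) (g (map suc (y ∷ r))))
    after y rewrite suc-≤ᵇ-suc (toℕ x) (toℕ y) with toℕ x ≤ᵇ toℕ y
    ... | true  = sumOver-after-suc l n y (g ∘ (suc y ∷_))
    ... | false = trans (sumOver-zero (vecs (suc l) n) (λ _ → refl)) (sym (sumOver-zero (vecs l n) (λ _ → refl)))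

  sumIncr-split-head : ∀ l n (f : Vec (Fin (suc l)) (suc n) → ℕ) →
    sumIncr (suc l) (suc n) f ≡ sumIncr (suc l) n (f ∘ (zero ∷_)) + sumIncr l (suc n) (f ∘ map suc)
  sumIncr-split-head l n f = begin
    sumIncr (suc l) (suc n) f
      ≡⟨ sumOver-vecs-suc (suc l) n _ ⟩
    sumOver (allFin (suc l)) (λ x → sumOver (vecs (suc l) n) (λ r → when (weaklyIncr (x ∷ r)) (f (x ∷ r))))
      ≡⟨ sumOver-allFin-suc l _ ⟩
    sumOver (vecs (suc l) n) (λ r → when (weaklyIncr (zero ∷ r)) (f (zero ∷ r))) +
    sumOver (allFin l) (λ x → sumOver (vecs (suc l) n) (λ r → when (weaklyIncr (suc x ∷ r)) (f (suc x ∷ r))))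
      ≡⟨ cong₂ _+_ (sumOver-cong (vecs (suc l) n) (λ r → cong (λ b → when b (f (zero ∷ r))) (weaklyIncr-zero∷ r)))
                   (sumOver-cong (allFin l) (λ x → sumOver-after-suc l n x (f ∘ (suc x ∷_)))) ⟩
    sumIncr (suc l) n (f ∘ (zero ∷_)) +
    sumOver (allFin l) (λ x → sumOver (vecs l n) (λ r → when (weaklyIncr (x ∷ r)) (f (map suc (x ∷ r)))))
      ≡⟨ cong (sumIncr (suc l) n (f ∘ (zero ∷_)) +_) (sumOver-vecs-suc l n _) ⟨
    sumIncr (suc l) n (f ∘ (zero ∷_)) + sumIncr l (suc n) (f ∘ map suc) ∎

  prependZeros : ∀ {l} k n → Vec (Fin l) (n ∸ k) → Vec (Fin (suc l)) n
  prependZeros zero    n       r = map suc r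
  prependZeros (suc k) zero    r = []
  prependZeros (suc k) (suc n) r = zero ∷ prependZeros k n r

  -- An increasing vector over Fin (suc l) is k zeros followed by an increasing vector over Fin l.
  sumIncr-suc : ∀ l n (f : Vec (Fin (suc l)) n → ℕ) →
                sumIncr (suc l) n f ≡ Σℕ≤ n (λ k → sumIncr l (n ∸ k) (f ∘ prependZeros k n))
  sumIncr-suc l zero    f = refl
  sumIncr-suc l (suc n) f = begin
    sumIncr (suc l) (suc n) f
      ≡⟨ sumIncr-split-head l n f ⟩
    sumIncr (suc l) n (f ∘ (zero ∷_)) + sumIncr l (suc n) (f ∘ map suc)
      ≡⟨ ℕP.+-comm (sumIncr (suc l) n (f ∘ (zero ∷_))) _ ⟩
    sumIncr l (suc n) (f ∘ map suc) + sumIncr (suc l) n (f ∘ (zero ∷_))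
      ≡⟨ cong (sumIncr l (suc n) (f ∘ map suc) +_) (sumIncr-suc l n (f ∘ (zero ∷_))) ⟩
    Σℕ≤ (suc n) (λ k → sumIncr l (suc n ∸ k) (f ∘ prependZeros k (suc n))) ∎

module SkewTableaux where
  open import Data.Bool using (Bool; true; false; _∧_)
  open import Data.Nat as ℕ using (ℕ; zero; suc; _+_; _∸_; _≤_; _≤ᵇ_; _<ᵇ_; _≡ᵇ_; s≤s)
  import Data.Nat.Properties as ℕP
  open import Data.Fin using (Fin; zero; suc; toℕ)
  open import Data.Vec using (Vec; []; _∷_; map)
  open import Data.List as List using (List; []; _∷_; allFin; filterᵇ; length)
  open import Data.List.Properties using (map-tabulate)
  open import Function using (id; _∘_)
  open import Relation.Binary.PropositionalEquality
  open ≡-Reasoning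
  open import Defs using (vecs; weaklyIncr; colStrict; count; allB; isSSYT; kostka2)
  open NatSums
  open IncreasingVectors

  -- Column strictness for the skew shape (m + a, b)/(m), whose second row starts
  -- m cells to the left of the first.
  skewColStrict : ∀ {l a b} → ℕ → Vec (Fin l) a → Vec (Fin l) b → Bool
  skewColStrict zero    r₁ r₂       = colStrict r₁ r₂
  skewColStrict (suc m) r₁ []       = true
  skewColStrict (suc m) r₁ (_ ∷ r₂) = skewColStrict m r₁ r₂

  colStrict-map-suc : ∀ {l a b} (r₁ : Vec (Fin l) a) (r₂ : Vec (Fin l) b) →
                      colStrict (map suc r₁) (map suc r₂) ≡ colStrict r₁ r₂
  colStrict-map-suc r₁       []       = refl
  colStrict-map-suc []       (y ∷ r₂) = refl
  colStrict-map-suc (x ∷ r₁) (y ∷ r₂) = cong ((toℕ x ℕ.<ᵇ toℕ y) ∧_) (colStrict-map-suc r₁ r₂)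

  skewColStrict-map-suc : ∀ {l a b} m (r₁ : Vec (Fin l) a) (r₂ : Vec (Fin l) b) →
                          skewColStrict m (map suc r₁) (map suc r₂) ≡ skewColStrict m r₁ r₂
  skewColStrict-map-suc zero    r₁ r₂       = colStrict-map-suc r₁ r₂
  skewColStrict-map-suc (suc m) r₁ []       = refl
  skewColStrict-map-suc (suc m) r₁ (y ∷ r₂) = skewColStrict-map-suc m r₁ r₂

  skewColStrict-zero∷ : ∀ {l a b} m (r₁ : Vec (Fin (suc l)) a) (r₂ : Vec (Fin l) b) →
                        skewColStrict m (zero ∷ r₁) (map suc r₂) ≡ skewColStrict (suc m) r₁ (map suc r₂)
  skewColStrict-zero∷ zero    r₁ []       = refl
  skewColStrict-zero∷ (suc m) r₁ []       = refl
  skewColStrict-zero∷ zero    r₁ (y ∷ r₂) = refl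
  skewColStrict-zero∷ (suc m) r₁ (y ∷ r₂) = skewColStrict-zero∷ m r₁ r₂

  -- Zeros in the first row only widen the overhang of the second row.
  skewColStrict-zeros₁ : ∀ {l b} m k a (r₁ : Vec (Fin l) (a ∸ k)) (r₂ : Vec (Fin l) b) → k ≤ a →
                         skewColStrict m (prependZeros k a r₁) (map suc r₂) ≡ skewColStrict (m + k) r₁ r₂
  skewColStrict-zeros₁ m zero    a       r₁ r₂ _ rewrite ℕP.+-identityʳ m = skewColStrict-map-suc m r₁ r₂
  skewColStrict-zeros₁ m (suc k) (suc a) r₁ r₂ (s≤s k≤a) = begin
    skewColStrict m (zero ∷ prependZeros k a r₁) (map suc r₂) ≡⟨ skewColStrict-zero∷ m (prependZeros k a r₁) r₂ ⟩
    skewColStrict (suc m) (prependZeros k a r₁) (map suc r₂)  ≡⟨ skewColStrict-zeros₁ (suc m) k a r₁ r₂ k≤a ⟩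
    skewColStrict (suc m + k) r₁ r₂                           ≡⟨ cong (λ o → skewColStrict o r₁ r₂) (ℕP.+-suc m k) ⟨
    skewColStrict (m + suc k) r₁ r₂                           ∎

  -- Zeros in the second row must lie in its overhang.
  skewColStrict-zeros₂ : ∀ {l a} m t b (r₁ : Vec (Fin (suc l)) a) (r₂ : Vec (Fin l) (b ∸ t)) → t ≤ b →
                         skewColStrict m r₁ (prependZeros t b r₂) ≡ (t ≤ᵇ m) ∧ skewColStrict (m ∸ t) r₁ (map suc r₂)
  skewColStrict-zeros₂ m       zero    b       r₁       r₂ _         = refl
  skewColStrict-zeros₂ zero    (suc t) (suc b) []       r₂ _         = refl
  skewColStrict-zeros₂ zero    (suc t) (suc b) (x ∷ r₁) r₂ _         = refl
  skewColStrict-zeros₂ (suc m) (suc t) (suc b) r₁       r₂ (s≤s t≤b) =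
    trans (skewColStrict-zeros₂ m t b r₁ r₂ t≤b)
          (cong (_∧ skewColStrict (m ∸ t) r₁ (map suc r₂)) (sym (suc-≤ᵇ-suc t m)))

  count-zero-map-suc : ∀ {l n} (r : Vec (Fin l) n) → count zero (map suc r) ≡ 0
  count-zero-map-suc []      = refl
  count-zero-map-suc (x ∷ r) = count-zero-map-suc r

  count-suc-map-suc : ∀ {l n} (v : Fin l) (r : Vec (Fin l) n) → count (suc v) (map suc r) ≡ count v r
  count-suc-map-suc v []      = refl
  count-suc-map-suc v (x ∷ r) = cong (_ +_) (count-suc-map-suc v r)

  count-zero-zeros : ∀ {l} k n (r : Vec (Fin l) (n ∸ k)) → k ≤ n → count zero (prependZeros k n r) ≡ k
  count-zero-zeros zero    n       r _         = count-zero-map-suc r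
  count-zero-zeros (suc k) (suc n) r (s≤s k≤n) = cong suc (count-zero-zeros k n r k≤n)

  count-suc-zeros : ∀ {l} (v : Fin l) k n (r : Vec (Fin l) (n ∸ k)) → k ≤ n →
                    count (suc v) (prependZeros k n r) ≡ count v r
  count-suc-zeros v zero    n       r _         = count-suc-map-suc v r
  count-suc-zeros v (suc k) (suc n) r (s≤s k≤n) = count-suc-zeros v k n r k≤n

  allB-cong : ∀ {A : Set} (xs : List A) {p q : A → Bool} → (∀ x → p x ≡ q x) → allB p xs ≡ allB q xs
  allB-cong []       p≡q = refl
  allB-cong (x ∷ xs) p≡q = cong₂ _∧_ (p≡q x) (allB-cong xs p≡q)

  allB-map : ∀ {A B : Set} (g : A → B) (xs : List A) p → allB p (List.map g xs) ≡ allB (p ∘ g) xs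
  allB-map g []       p = refl
  allB-map g (x ∷ xs) p = cong (p (g x) ∧_) (allB-map g xs p)

  allB-allFin-suc : ∀ l (p : Fin (suc l) → Bool) → allB p (allFin (suc l)) ≡ p zero ∧ allB (p ∘ suc) (allFin l)
  allB-allFin-suc l p =
    cong (p zero ∧_) (trans (cong (allB p) (sym (map-tabulate id suc))) (allB-map suc (allFin l) p))

  when-∧ : ∀ p q n → when (p ∧ q) n ≡ when p (when q n)
  when-∧ false q n = refl
  when-∧ true  q n = refl

  length-filterᵇ : ∀ {A : Set} (p : A → Bool) xs → length (filterᵇ p xs) ≡ sumOver xs (λ x → when (p x) 1)
  length-filterᵇ p []       = refl
  length-filterᵇ p (x ∷ xs) with p x
  ... | true  = cong suc (length-filterᵇ p xs)
  ... | false = length-filterᵇ p xs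

  module _ (d : ℕ) where

    hasContent : ∀ {l a b} → Vec (Fin l) a → Vec (Fin l) b → Bool
    hasContent {l} r₁ r₂ = allB (λ v → count v r₁ + count v r₂ ≡ᵇ d) (allFin l)

    isSkewSSYT : ∀ {l a b} → ℕ → Vec (Fin l) a → Vec (Fin l) b → Bool
    isSkewSSYT m r₁ r₂ = skewColStrict m r₁ r₂ ∧ hasContent r₁ r₂

    -- Fillings of (m + a, b)/(m) with content (d, …, d) (l entries).
    skewKostka : ℕ → ℕ → ℕ → ℕ → ℕ
    skewKostka l m a b = sumIncr l a (λ r₁ → sumIncr l b (λ r₂ → when (isSkewSSYT m r₁ r₂) 1))

    hasContent-zeros : ∀ {l} k a t b (r₁ : Vec (Fin l) (a ∸ k)) (r₂ : Vec (Fin l) (b ∸ t)) → k ≤ a → t ≤ b →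
      hasContent (prependZeros k a r₁) (prependZeros t b r₂) ≡ (k + t ≡ᵇ d) ∧ hasContent r₁ r₂
    hasContent-zeros {l} k a t b r₁ r₂ k≤a t≤b = trans (allB-allFin-suc l _) (cong₂ _∧_
      (cong₂ (λ u w → u + w ≡ᵇ d) (count-zero-zeros k a r₁ k≤a) (count-zero-zeros t b r₂ t≤b))
      (allB-cong (allFin l) (λ v → cong₂ (λ u w → u + w ≡ᵇ d) (count-suc-zeros v k a r₁ k≤a)
                                                             (count-suc-zeros v t b r₂ t≤b))))

    isSkewSSYT-zeros : ∀ {l} m k a t b (r₁ : Vec (Fin l) (a ∸ k)) (r₂ : Vec (Fin l) (b ∸ t)) → k ≤ a → t ≤ b →
      when (isSkewSSYT m (prependZeros k a r₁) (prependZeros t b r₂)) 1 ≡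
      when (t ≤ᵇ m) (when (k + t ≡ᵇ d) (when (isSkewSSYT (m ∸ t + k) r₁ r₂) 1))
    isSkewSSYT-zeros m k a t b r₁ r₂ k≤a t≤b = begin
      when (isSkewSSYT m (prependZeros k a r₁) (prependZeros t b r₂)) 1
        ≡⟨ cong₂ (λ p q → when (p ∧ q) 1) columns (hasContent-zeros k a t b r₁ r₂ k≤a t≤b) ⟩
      when (((t ≤ᵇ m) ∧ col) ∧ ((k + t ≡ᵇ d) ∧ cnt)) 1
        ≡⟨ when-∧ ((t ≤ᵇ m) ∧ col) _ 1 ⟩
      when ((t ≤ᵇ m) ∧ col) (when ((k + t ≡ᵇ d) ∧ cnt) 1)
        ≡⟨ trans (when-∧ (t ≤ᵇ m) col _) (cong (when (t ≤ᵇ m) ∘ when col) (when-∧ (k + t ≡ᵇ d) cnt 1)) ⟩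
      when (t ≤ᵇ m) (when col (when (k + t ≡ᵇ d) (when cnt 1)))
        ≡⟨ cong (when (t ≤ᵇ m)) (when-swap col (k + t ≡ᵇ d) _) ⟩
      when (t ≤ᵇ m) (when (k + t ≡ᵇ d) (when col (when cnt 1)))
        ≡⟨ cong (when (t ≤ᵇ m) ∘ when (k + t ≡ᵇ d)) (when-∧ col cnt 1) ⟨
      when (t ≤ᵇ m) (when (k + t ≡ᵇ d) (when (isSkewSSYT (m ∸ t + k) r₁ r₂) 1)) ∎
      where
      col : Bool
      col = skewColStrict (m ∸ t + k) r₁ r₂
      cnt : Bool
      cnt = hasContent r₁ r₂
      columns : skewColStrict m (prependZeros k a r₁) (prependZeros t b r₂) ≡ (t ≤ᵇ m) ∧ col
      columns = trans (skewColStrict-zeros₂ m t b (prependZeros k a r₁) r₂ t≤b)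
                      (cong ((t ≤ᵇ m) ∧_) (skewColStrict-zeros₁ (m ∸ t) k a r₁ r₂ k≤a))

    skewKostka-suc : ∀ l m a b → skewKostka (suc l) m a b ≡
      Σℕ≤ a (λ k → Σℕ≤ b (λ t →
        when (t ≤ᵇ m) (when (k + t ≡ᵇ d) (skewKostka l (m ∸ t + k) (a ∸ k) (b ∸ t)))))
    skewKostka-suc l m a b = begin
      skewKostka (suc l) m a b
        ≡⟨ sumIncr-suc l a _ ⟩
      Σℕ≤ a (λ k → sumIncr l (a ∸ k) (λ r₁ →
                     sumIncr (suc l) b (λ r₂ → when (isSkewSSYT m (prependZeros k a r₁) r₂) 1)))
        ≡⟨ Σℕ≤-cong a (λ k k≤a → sumIncr-cong l (a ∸ k) (second-row k k≤a)) ⟩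
      Σℕ≤ a (λ k → sumIncr l (a ∸ k) (λ r₁ →
                     Σℕ≤ b (λ t → when (t ≤ᵇ m) (when (k + t ≡ᵇ d) (rest k t r₁)))))
        ≡⟨ Σℕ≤-cong a (λ k _ → trans (sumIncr-Σℕ≤-comm l (a ∸ k) b _) (Σℕ≤-cong b λ t _ → whens k t)) ⟩
      Σℕ≤ a (λ k → Σℕ≤ b (λ t →
        when (t ≤ᵇ m) (when (k + t ≡ᵇ d) (skewKostka l (m ∸ t + k) (a ∸ k) (b ∸ t))))) ∎
      where
      rest : ∀ k t → Vec (Fin l) (a ∸ k) → ℕ
      rest k t r₁ = sumIncr l (b ∸ t) (λ r₂ → when (isSkewSSYT (m ∸ t + k) r₁ r₂) 1)

      second-row : ∀ k → k ≤ a → ∀ r₁ →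
        sumIncr (suc l) b (λ r₂ → when (isSkewSSYT m (prependZeros k a r₁) r₂) 1) ≡
        Σℕ≤ b (λ t → when (t ≤ᵇ m) (when (k + t ≡ᵇ d) (rest k t r₁)))
      second-row k k≤a r₁ = trans (sumIncr-suc l b _) (Σℕ≤-cong b λ t t≤b → begin
        sumIncr l (b ∸ t) (λ r₂ → when (isSkewSSYT m (prependZeros k a r₁) (prependZeros t b r₂)) 1)
          ≡⟨ sumIncr-cong l (b ∸ t) (λ r₂ → isSkewSSYT-zeros m k a t b r₁ r₂ k≤a t≤b) ⟩
        sumIncr l (b ∸ t) (λ r₂ → when (t ≤ᵇ m) (when (k + t ≡ᵇ d) (when (isSkewSSYT (m ∸ t + k) r₁ r₂) 1)))
          ≡⟨ sumIncr-when l (b ∸ t) (t ≤ᵇ m) _ ⟩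
        when (t ≤ᵇ m) (sumIncr l (b ∸ t) (λ r₂ → when (k + t ≡ᵇ d) (when (isSkewSSYT (m ∸ t + k) r₁ r₂) 1)))
          ≡⟨ cong (when (t ≤ᵇ m)) (sumIncr-when l (b ∸ t) (k + t ≡ᵇ d) _) ⟩
        when (t ≤ᵇ m) (when (k + t ≡ᵇ d) (rest k t r₁)) ∎)

      whens : ∀ k t → sumIncr l (a ∸ k) (λ r₁ → when (t ≤ᵇ m) (when (k + t ≡ᵇ d) (rest k t r₁))) ≡
                      when (t ≤ᵇ m) (when (k + t ≡ᵇ d) (skewKostka l (m ∸ t + k) (a ∸ k) (b ∸ t)))
      whens k t = trans (sumIncr-when l (a ∸ k) (t ≤ᵇ m) _)
                        (cong (when (t ≤ᵇ m)) (sumIncr-when l (a ∸ k) (k + t ≡ᵇ d) _))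

    kostka2≡skewKostka : ∀ l a b → kostka2 a b d l ≡ skewKostka l 0 a b
    kostka2≡skewKostka l a b = trans (sum-map _ (vecs l a)) (sumOver-cong (vecs l a) λ r₁ → begin
      length (filterᵇ (isSSYT d r₁) (vecs l b))
        ≡⟨ length-filterᵇ (isSSYT d r₁) (vecs l b) ⟩
      sumOver (vecs l b) (λ r₂ → when (isSSYT d r₁ r₂) 1)
        ≡⟨ sumOver-cong (vecs l b) (λ r₂ → trans (when-∧ (weaklyIncr r₁) _ 1)
                                                (cong (when (weaklyIncr r₁)) (when-∧ (weaklyIncr r₂) _ 1))) ⟩
      sumOver (vecs l b) (λ r₂ → when (weaklyIncr r₁) (when (weaklyIncr r₂) (when (isSkewSSYT 0 r₁ r₂) 1)))
        ≡⟨ sumOver-when (vecs l b) (weaklyIncr r₁) _ ⟩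
      when (weaklyIncr r₁) (sumIncr l b (λ r₂ → when (isSkewSSYT 0 r₁ r₂) 1)) ∎)

module SkewKostkaFormula (d : ℕ) where
  open import Data.Nat as ℕ using (ℕ; zero; suc; _≤_; _<_; _∸_; _⊓_; _≤ᵇ_; _≡ᵇ_; s≤s)
  import Data.Nat.Properties as ℕP
  open import Data.Integer using (ℤ; +_; _+_; _-_)
  import Data.Integer.Properties as ℤP
  open import Data.Integer.Tactic.RingSolver using (solve-∀)
  import Data.Nat.Tactic.RingSolver as ℕRing
  open import Data.Sum using (_⊎_; inj₁; inj₂)
  open import Function using (_∘_)
  open import Relation.Nullary using (¬_; Dec; yes; no; contradiction)
  open import Relation.Nullary.Decidable using (dec-true; dec-false)
  open import Relation.Binary.PropositionalEquality
  open ≡-Reasoning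
  open import Defs using (Σ≤; kostka2)
  open IntegerSums
  open NatSums using (when; Σℕ≤; Σℕ≤-cong; Σℕ≤-zero; Σℕ≤-single; Σℕ≤-comm)
  open SkewTableaux using (skewKostka; skewKostka-suc; kostka2≡skewKostka)
  open Coefficients d

  +-Σℕ≤ : ∀ n (f : ℕ → ℕ) → + Σℕ≤ n f ≡ Σ≤ n (λ k → + f k)
  +-Σℕ≤ zero    f = refl
  +-Σℕ≤ (suc n) f = trans (cong (λ s → + f 0 + s) (+-Σℕ≤ n (f ∘ suc))) (sym (Σ≤-unfoldˡ n _))

  window-difference : ∀ {f} → SupportedOnℕ f → ∀ m x →
    Σ≤ (m ⊓ d) (λ t → f (x - + t) - f (x - + suc m - + d + + t)) ≡ window f x - window f (x - + suc m)
  window-difference {f} supp m x = begin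
    Σ≤ (m ⊓ d) (λ t → f (x - + t) - f (y + + t))
      ≡⟨ Σ≤-distrib-sub (m ⊓ d) _ _ ⟩
    Σ≤ (m ⊓ d) (λ t → f (x - + t)) - Σ≤ (m ⊓ d) (λ t → f (y + + t))
      ≡⟨ cong₂ _-_ (Σ≤-downward supp (m ⊓ d) x)
                   (trans (Σ≤-upward supp (m ⊓ d) y) (cong (λ z → P (y + + (m ⊓ d)) - P z) (y-1 x (+ m) (+ d)))) ⟩
    (P x - P (x - + suc (m ⊓ d))) - (P (y + + (m ⊓ d)) - P (x - + suc m - + suc d))
      ≡⟨ corners (ℕP.⊓-sel m d) ⟩
    (P x - P (x - + suc d)) - (P (x - + suc m) - P (x - + suc m - + suc d))
      ≡⟨ cong₂ _-_ (Σ≤-downward supp d x) (Σ≤-downward supp d (x - + suc m)) ⟨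
    window f x - window f (x - + suc m) ∎
    where
    P : ℤ → ℤ
    P = prefixSum f
    y : ℤ
    y = x - + suc m - + d
    y-1 : ∀ x m d → x - (+ 1 + m) - d - + 1 ≡ x - (+ 1 + m) - (+ 1 + d)
    y-1 = solve-∀
    corners : ∀ {c} → c ≡ m ⊎ c ≡ d →
      (P x - P (x - + suc c)) - (P (y + + c) - P (x - + suc m - + suc d)) ≡
      (P x - P (x - + suc d)) - (P (x - + suc m) - P (x - + suc m - + suc d))
    corners (inj₁ refl) = trans (cong (λ z → (P x - P (x - + suc m)) - (P z - P (x - + suc m - + suc d)))
                                      (add-back x (+ m) (+ d)))
                                (swap (P x) (P (x - + suc m)) (P (x - + suc d)) _)
      where
      add-back : ∀ x m d → x - (+ 1 + m) - d + m ≡ x - (+ 1 + d)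
      add-back = solve-∀
      swap : ∀ a p q r → (a - p) - (q - r) ≡ (a - q) - (p - r)
      swap = solve-∀
    corners (inj₂ refl) = cong (λ z → (P x - P (x - + suc d)) - (P z - P (x - + suc m - + suc d)))
                               (add-back x (+ m) (+ d))
      where
      add-back : ∀ x m d → x - (+ 1 + m) - d + d ≡ x - (+ 1 + m)
      add-back = solve-∀

  FormulaHolds : ℕ → Set
  FormulaHolds l = ∀ m a b → a ℕ.+ b ≡ d ℕ.* l → b ≤ a ℕ.+ m →
    + skewKostka d l m a b ≡ compositions l (+ b) - compositions l (+ b - + suc m)

  module Step {l} (IH : FormulaHolds l) (m a b : ℕ)
              (a+b≡d[1+l] : a ℕ.+ b ≡ d ℕ.* suc l) (b≤a+m : b ≤ a ℕ.+ m) where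

    N : ℤ → ℤ
    N = compositions l

    y : ℤ
    y = + b - + suc m - + d

    remaining : ℕ → ℕ → ℕ
    remaining t k = skewKostka d l (m ∸ t ℕ.+ k) (a ∸ k) (b ∸ t)

    -- Fillings with exactly t zeros in the second row.
    withZerosInRow₂ : ℕ → ℤ
    withZerosInRow₂ t = + Σℕ≤ a (λ k → when (t ≤ᵇ m) (when (k ℕ.+ t ≡ᵇ d) (remaining t k)))

    h : ℕ → ℤ
    h t = N (+ b - + t) - N (y + + t)

    a+b≡d+dl : a ℕ.+ b ≡ d ℕ.+ d ℕ.* l
    a+b≡d+dl = trans a+b≡d[1+l] (ℕP.*-suc d l)

    far-end-vanishes : ∀ {t} → b ℕ.+ t ≤ m ℕ.+ d → N (y + + t) ≡ + 0
    far-end-vanishes {t} b+t≤m+d = begin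
      N (y + + t)                         ≡⟨ cong N (regroup (+ b) (+ m) (+ d) (+ t)) ⟩
      N (+ (b ℕ.+ t) - + (suc m ℕ.+ d))   ≡⟨ supported-< {N} (compositions-supported l) (s≤s b+t≤m+d) ⟩
      + 0                                 ∎
      where
      regroup : ∀ b m d t → b - (+ 1 + m) - d + t ≡ (b + t) - (+ 1 + m + d)
      regroup = solve-∀

    expand : + skewKostka d (suc l) m a b ≡ Σ≤ b withZerosInRow₂
    expand = trans (cong +_ (trans (skewKostka-suc d l m a b) (Σℕ≤-comm a b _))) (+-Σℕ≤ b _)

    outside : ∀ t → t ≤ b → m ⊓ d < t → withZerosInRow₂ t ≡ + 0
    outside t _ m⊓d<t with t ℕP.≤? m
    ... | no  t≰m = cong +_ (Σℕ≤-zero a λ k _ →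
                      cong (λ p → when p (when (k ℕ.+ t ≡ᵇ d) (remaining t k))) (dec-false (t ℕP.≤? m) t≰m))
    ... | yes t≤m = cong +_ (Σℕ≤-zero a λ k _ →
                      cong₂ (λ p q → when p (when q (remaining t k)))
                            (dec-true (t ℕP.≤? m) t≤m) (dec-false (_ ℕP.≟ d) (k+t≢d k)))
      where
      k+t≢d : ∀ k → ¬ k ℕ.+ t ≡ d
      k+t≢d k k+t≡d = ℕP.<⇒≱ m⊓d<t (ℕP.⊓-glb t≤m (subst (t ≤_) k+t≡d (ℕP.m≤n+m t k)))

    beyond-b : ∀ t → b < t → t ≤ m ⊓ d → h t ≡ + 0
    beyond-b t b<t t≤m⊓d = cong₂ _-_ (supported-< {N} (compositions-supported l) b<t) (far-end-vanishes b+t≤m+d)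
      where
      b+t≤m+d : b ℕ.+ t ≤ m ℕ.+ d
      b+t≤m+d = ℕP.+-mono-≤ (ℕP.≤-trans (ℕP.<⇒≤ b<t) (ℕP.≤-trans t≤m⊓d (ℕP.m⊓n≤m m d)))
                            (ℕP.≤-trans t≤m⊓d (ℕP.m⊓n≤n m d))

    -- The case where the d − t zeros of the first row fit into it.
    module Fits {t} (t≤b : t ≤ b) (t≤m : t ≤ m) (t≤d : t ≤ d) (k≤a : d ∸ t ≤ a) where
      k : ℕ
      k = d ∸ t

      ιa : + (a ∸ k) ≡ + a - (+ d - + t)
      ιa = trans (sym (m-n≡m∸n k≤a)) (cong (λ z → + a - z) (sym (m-n≡m∸n t≤d)))
      ιb : + (b ∸ t) ≡ + b - + t
      ιb = sym (m-n≡m∸n t≤b)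
      ιm+k : + (m ∸ t ℕ.+ k) ≡ (+ m - + t) + (+ d - + t)
      ιm+k = cong₂ _+_ (sym (m-n≡m∸n t≤m)) (sym (m-n≡m∸n t≤d))

      sum-fits : (a ∸ k) ℕ.+ (b ∸ t) ≡ d ℕ.* l
      sum-fits = ℤP.+-injective (begin
        + (a ∸ k) + + (b ∸ t)                  ≡⟨ cong₂ _+_ ιa ιb ⟩
        (+ a - (+ d - + t)) + (+ b - + t)      ≡⟨ regroup (+ a) (+ b) (+ d) (+ t) ⟩
        (+ a + + b) - + d                      ≡⟨ cong (λ z → + z - + d) a+b≡d+dl ⟩
        (+ d + + (d ℕ.* l)) - + d              ≡⟨ cancel (+ d) (+ (d ℕ.* l)) ⟩
        + (d ℕ.* l)                            ∎)
        where
        regroup : ∀ a b d t → (a - (d - t)) + (b - t) ≡ (a + b) - d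
        regroup = solve-∀
        cancel : ∀ d x → (d + x) - d ≡ x
        cancel = solve-∀

      overhang-fits : b ∸ t ≤ (a ∸ k) ℕ.+ (m ∸ t ℕ.+ k)
      overhang-fits = ℕP.≤-trans (ℕP.∸-monoˡ-≤ t b≤a+m) (ℕP.≤-reflexive (ℤP.+-injective (begin
        + (a ℕ.+ m ∸ t)                                    ≡⟨ m-n≡m∸n (ℕP.≤-trans t≤m (ℕP.m≤n+m m a)) ⟨
        + a + + m - + t                                    ≡⟨ regroup (+ a) (+ m) (+ d) (+ t) ⟩
        (+ a - (+ d - + t)) + ((+ m - + t) + (+ d - + t))  ≡⟨ cong₂ _+_ ιa ιm+k ⟨
        + (a ∸ k) + + (m ∸ t ℕ.+ k)                        ∎)))
        where
        regroup : ∀ a m d t → a + m - t ≡ (a - (d - t)) + ((m - t) + (d - t))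
        regroup = solve-∀

      shift-fits : + (b ∸ t) - + suc (m ∸ t ℕ.+ k) ≡ y + + t
      shift-fits = begin
        + (b ∸ t) - (+ 1 + + (m ∸ t ℕ.+ k))                 ≡⟨ cong₂ (λ u v → u - (+ 1 + v)) ιb ιm+k ⟩
        (+ b - + t) - (+ 1 + ((+ m - + t) + (+ d - + t)))   ≡⟨ regroup (+ b) (+ m) (+ d) (+ t) ⟩
        y + + t                                             ∎
        where
        regroup : ∀ b m d t → (b - t) - (+ 1 + ((m - t) + (d - t))) ≡ b - (+ 1 + m) - d + t
        regroup = solve-∀

      inside-fits : + remaining t k ≡ h t
      inside-fits = begin
        + remaining t k
          ≡⟨ IH (m ∸ t ℕ.+ k) (a ∸ k) (b ∸ t) sum-fits overhang-fits ⟩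
        N (+ (b ∸ t)) - N (+ (b ∸ t) - + suc (m ∸ t ℕ.+ k))
          ≡⟨ cong₂ (λ u v → N u - N v) ιb shift-fits ⟩
        h t ∎

    -- The case where they do not: then b − t exceeds d l and both terms of h t vanish.
    inside-overflows : ∀ {t} → t ≤ d → a < d ∸ t → h t ≡ + 0
    inside-overflows {t} t≤d a<d∸t = cong₂ _-_ near-end (far-end-vanishes b+t≤m+d)
      where
      a+t<d : suc a ℕ.+ t ≤ d
      a+t<d = ℕP.m≤o∸n⇒m+n≤o (suc a) t≤d a<d∸t

      dl+t<b : suc (d ℕ.* l) ℕ.+ t ≤ b
      dl+t<b = ℕP.+-cancelˡ-≤ a _ _ (ℕP.≤-trans
        (ℕP.≤-reflexive (regroup a (d ℕ.* l) t))
        (ℕP.≤-trans (ℕP.+-monoˡ-≤ (d ℕ.* l) a+t<d) (ℕP.≤-reflexive (sym a+b≡d+dl))))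
        where
        regroup : ∀ a x t → a ℕ.+ ((1 ℕ.+ x) ℕ.+ t) ≡ ((1 ℕ.+ a) ℕ.+ t) ℕ.+ x
        regroup = ℕRing.solve-∀

      near-end : N (+ b - + t) ≡ + 0
      near-end = trans (cong N (m-n≡m∸n (ℕP.≤-trans (ℕP.m≤n+m t _) dl+t<b)))
                       (compositions-above l (b ∸ t) (ℕP.m+n≤o⇒m≤o∸n (suc (d ℕ.* l)) dl+t<b))

      b+t≤m+d : b ℕ.+ t ≤ m ℕ.+ d
      b+t≤m+d = ℕP.≤-trans (ℕP.+-monoˡ-≤ t b≤a+m)
                (ℕP.≤-trans (ℕP.≤-reflexive (regroup a m t))
                            (ℕP.+-monoʳ-≤ m (ℕP.≤-trans (ℕP.n≤1+n _) a+t<d)))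
        where
        regroup : ∀ a m t → (a ℕ.+ m) ℕ.+ t ≡ m ℕ.+ (a ℕ.+ t)
        regroup = ℕRing.solve-∀

    inside : ∀ t → t ≤ b → t ≤ m ⊓ d → withZerosInRow₂ t ≡ h t
    inside t t≤b t≤m⊓d = begin
      withZerosInRow₂ t
        ≡⟨ cong +_ (Σℕ≤-cong a λ k _ →
             cong (λ p → when p (when (k ℕ.+ t ≡ᵇ d) (remaining t k))) (dec-true (t ℕP.≤? m) t≤m)) ⟩
      + Σℕ≤ a (λ k → when (k ℕ.+ t ≡ᵇ d) (remaining t k))
        ≡⟨ zeros-in-row₁ (d ∸ t ℕP.≤? a) ⟩
      h t ∎
      where
      t≤m : t ≤ m
      t≤m = ℕP.≤-trans t≤m⊓d (ℕP.m⊓n≤m m d)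
      t≤d : t ≤ d
      t≤d = ℕP.≤-trans t≤m⊓d (ℕP.m⊓n≤n m d)

      only-d∸t : ∀ k → ¬ k ≡ d ∸ t → when (k ℕ.+ t ≡ᵇ d) (remaining t k) ≡ 0
      only-d∸t k k≢d∸t = cong (λ q → when q (remaining t k))
        (dec-false (_ ℕP.≟ d) (λ k+t≡d → k≢d∸t (trans (sym (ℕP.m+n∸n≡m k t)) (cong (_∸ t) k+t≡d))))

      zeros-in-row₁ : Dec (d ∸ t ≤ a) → + Σℕ≤ a (λ k → when (k ℕ.+ t ≡ᵇ d) (remaining t k)) ≡ h t
      zeros-in-row₁ (yes d∸t≤a) = begin
        + Σℕ≤ a (λ k → when (k ℕ.+ t ≡ᵇ d) (remaining t k))
          ≡⟨ cong +_ (Σℕ≤-single a d∸t≤a only-d∸t) ⟩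
        + when (d ∸ t ℕ.+ t ≡ᵇ d) (remaining t (d ∸ t))
          ≡⟨ cong (λ q → + when q (remaining t (d ∸ t))) (dec-true (_ ℕP.≟ d) (ℕP.m∸n+n≡m t≤d)) ⟩
        + remaining t (d ∸ t)
          ≡⟨ Fits.inside-fits t≤b t≤m t≤d d∸t≤a ⟩
        h t ∎
      zeros-in-row₁ (no d∸t≰a) =
        trans (cong +_ (Σℕ≤-zero a λ k k≤a → only-d∸t k (λ k≡d∸t → d∸t≰a (subst (_≤ a) k≡d∸t k≤a))))
              (sym (inside-overflows t≤d (ℕP.≰⇒> d∸t≰a)))

    skewKostka-suc-formula :
      + skewKostka d (suc l) m a b ≡ compositions (suc l) (+ b) - compositions (suc l) (+ b - + suc m)
    skewKostka-suc-formula = begin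
      + skewKostka d (suc l) m a b   ≡⟨ expand ⟩
      Σ≤ b withZerosInRow₂           ≡⟨ Σ≤-truncate b (m ⊓ d) withZerosInRow₂ h inside outside beyond-b ⟩
      Σ≤ (m ⊓ d) h                   ≡⟨ window-difference {N} (compositions-supported l) m (+ b) ⟩
      compositions (suc l) (+ b) - compositions (suc l) (+ b - + suc m) ∎

  skewKostka-formula : ∀ l → FormulaHolds l
  skewKostka-formula zero    zero    zero    zero    _ _ = refl
  skewKostka-formula zero    (suc m) zero    zero    _ _ = refl
  skewKostka-formula zero    m       zero    (suc b) a+b≡0 _ = contradiction (trans a+b≡0 (ℕP.*-zeroʳ d)) (λ ())
  skewKostka-formula zero    m       (suc a) b       a+b≡0 _ = contradiction (trans a+b≡0 (ℕP.*-zeroʳ d)) (λ ())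
  skewKostka-formula (suc l) m a b a+b≡ b≤a+m =
    Step.skewKostka-suc-formula (skewKostka-formula l) m a b a+b≡ b≤a+m

  kostka2-formula : ∀ l a b → a ℕ.+ b ≡ d ℕ.* l → b ≤ a → + kostka2 a b d l ≡ Δ (compositions l) (+ b)
  kostka2-formula l a b a+b≡dl b≤a = trans (cong +_ (kostka2≡skewKostka d l a b))
    (skewKostka-formula l 0 a b a+b≡dl (subst (b ≤_) (sym (ℕP.+-identityʳ a)) b≤a))

module TwoRowMultiplicity where
  open import Data.Bool using (true; false; _∧_)
  open import Data.Bool.Properties using (T-∧; T-≡)
  open import Data.Nat using (suc; _+_; _*_; _∸_; _≤_; _≤ᵇ_; _≡ᵇ_; _%_)
  import Data.Nat.Properties as ℕP
  open import Data.Nat.DivMod using (m*n%n≡0)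
  open import Data.List using (upTo)
  open import Data.Product using (_,_)
  open import Function using (id)
  open import Function.Bundles using (Equivalence)
  open import Relation.Nullary using (contradiction)
  open import Relation.Nullary.Decidable using (dec-true)
  open import Relation.Binary.PropositionalEquality
  open ≡-Reasoning
  open import Defs using (K; kostka2)
  open NatSums

  selected⇒D∸i≡2b : ∀ D i b → ((b ≤ᵇ D ∸ b) ∧ (D ∸ b ∸ b ≡ᵇ i)) ≡ true → D ∸ i ≡ 2 * b
  selected⇒D∸i≡2b D i b selected with Equivalence.to T-∧ (Equivalence.from T-≡ selected)
  ... | b≤D∸bᵇ , D∸b∸b≡iᵇ = begin
    D ∸ i                 ≡⟨ cong (D ∸_) (ℕP.≡ᵇ⇒≡ (D ∸ b ∸ b) i D∸b∸b≡iᵇ) ⟨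
    D ∸ (D ∸ b ∸ b)       ≡⟨ cong (D ∸_) (ℕP.∸-+-assoc D b b) ⟩
    D ∸ (D ∸ (b + b))     ≡⟨ ℕP.m∸[m∸n]≡n (ℕP.m≤o∸n⇒m+n≤o b b≤D b≤D∸b) ⟩
    b + b                 ≡⟨ cong (b +_) (ℕP.+-identityʳ b) ⟨
    2 * b                 ∎
    where
    b≤D∸b : b ≤ D ∸ b
    b≤D∸b = ℕP.≤ᵇ⇒≤ b (D ∸ b) b≤D∸bᵇ
    b≤D : b ≤ D
    b≤D = ℕP.≤-trans b≤D∸b (ℕP.m∸n≤m D b)

  K≡Σℕ≤ : ∀ i d l → K i d l ≡
    Σℕ≤ (d * l) (λ b → when ((b ≤ᵇ d * l ∸ b) ∧ (d * l ∸ b ∸ b ≡ᵇ i)) (kostka2 (d * l ∸ b) b d l))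
  K≡Σℕ≤ i d l = trans (sum-map _ (upTo (suc (d * l)))) (sumOver-applyUpTo id (d * l) _)

  K-odd : ∀ i d l → (d * l ∸ i) % 2 ≡ 1 → K i d l ≡ 0
  K-odd i d l odd = trans (K≡Σℕ≤ i d l) (Σℕ≤-zero (d * l) λ b _ → when-false _ λ selected →
    contradiction (trans (sym odd) (even b selected)) (λ ()))
    where
    even : ∀ b → ((b ≤ᵇ d * l ∸ b) ∧ (d * l ∸ b ∸ b ≡ᵇ i)) ≡ true → (d * l ∸ i) % 2 ≡ 0
    even b selected = begin
      (d * l ∸ i) % 2   ≡⟨ cong (_% 2) (selected⇒D∸i≡2b (d * l) i b selected) ⟩
      (2 * b) % 2       ≡⟨ cong (_% 2) (ℕP.*-comm 2 b) ⟩
      (b * 2) % 2       ≡⟨ m*n%n≡0 b 2 ⟩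
      0                 ∎

  two-row-lengths : ∀ {D i} s → i ≤ D → D ∸ i ≡ 2 * s → (s + i) + s ≡ D
  two-row-lengths {D} {i} s i≤D D∸i≡2s = begin
    (s + i) + s   ≡⟨ ℕP.+-assoc s i s ⟩
    s + (i + s)   ≡⟨ cong (s +_) (ℕP.+-comm i s) ⟩
    s + (s + i)   ≡⟨ ℕP.+-assoc s s i ⟨
    (s + s) + i   ≡⟨ cong (λ n → (s + n) + i) (ℕP.+-identityʳ s) ⟨
    2 * s + i     ≡⟨ cong (_+ i) D∸i≡2s ⟨
    D ∸ i + i     ≡⟨ ℕP.m∸n+n≡m i≤D ⟩
    D             ∎

  K-even : ∀ i d l s → i ≤ d * l → d * l ∸ i ≡ 2 * s → K i d l ≡ kostka2 (s + i) s d l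
  K-even i d l s i≤D D∸i≡2s = begin
    K i d l
      ≡⟨ K≡Σℕ≤ i d l ⟩
    Σℕ≤ D (λ b → when ((b ≤ᵇ D ∸ b) ∧ (D ∸ b ∸ b ≡ᵇ i)) (kostka2 (D ∸ b) b d l))
      ≡⟨ Σℕ≤-single D s≤D (λ b b≢s → when-false _ λ selected →
           b≢s (ℕP.*-cancelˡ-≡ b s 2 (trans (sym (selected⇒D∸i≡2b D i b selected)) D∸i≡2s))) ⟩
    when ((s ≤ᵇ D ∸ s) ∧ (D ∸ s ∸ s ≡ᵇ i)) (kostka2 (D ∸ s) s d l)
      ≡⟨ cong (λ a → when ((s ≤ᵇ a) ∧ (a ∸ s ≡ᵇ i)) (kostka2 a s d l)) D∸s≡s+i ⟩
    when ((s ≤ᵇ s + i) ∧ (s + i ∸ s ≡ᵇ i)) (kostka2 (s + i) s d l)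
      ≡⟨ cong₂ (λ p q → when (p ∧ q) (kostka2 (s + i) s d l))
               (dec-true (s ℕP.≤? s + i) (ℕP.m≤m+n s i)) (dec-true (_ ℕP.≟ i) (ℕP.m+n∸m≡n s i)) ⟩
    kostka2 (s + i) s d l ∎
    where
    D : ℕ
    D = d * l
    D∸s≡s+i : D ∸ s ≡ s + i
    D∸s≡s+i = trans (cong (_∸ s) (sym (two-row-lengths s i≤D D∸i≡2s))) (ℕP.m+n∸n≡m (s + i) s)
    s≤D : s ≤ D
    s≤D = subst (s ≤_) (two-row-lengths s i≤D D∸i≡2s) (ℕP.m≤n+m s (s + i))

open import Defs
open import Data.Nat using (suc; _+_; _*_; _∸_; _≤_; _/_; _%_; s≤s)
open import Data.Nat.Combinatorics using (_C_)
open import Data.Integer using (ℤ; +_) renaming (_*_ to _*ℤ_)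
open import Data.Product using (_×_; _,_)
open import Relation.Binary.PropositionalEquality using (_≡_)

corollary2p6 : (d l i : ℕ) → 1 ≤ d → 2 ≤ l → i ≤ d * l →
    (((d * l ∸ i) % 2 ≡ 1 → K i d l ≡ 0)
    × ((s : ℕ) → d * l ∸ i ≡ 2 * s →
    + K i d l ≡ Σ≤ ((d * l ∸ i) / (2 + 2 * d))
    (λ j → sgn j *ℤ (+ (l C j))
    *ℤ (+ ((s ∸ j * (1 + d) + (l ∸ 2)) C (l ∸ 2))))))
corollary2p6 d 0             i _ ()        _
corollary2p6 d 1             i _ (s≤s ())  _
corollary2p6 d l@(suc (suc l′)) i _ _ i≤dl = K-odd i d l , even
  where
  open import Data.Nat.Properties using (m≤m+n; *-suc)
  open import Data.Nat.DivMod using (/-congˡ; /-congʳ; m*n/m*o≡n/o)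
  open import Relation.Binary.PropositionalEquality using (cong; trans; sym; module ≡-Reasoning)
  open ≡-Reasoning
  open TwoRowMultiplicity using (K-odd; K-even; two-row-lengths)
  open IntegerSums using (Δ)
  open Coefficients d using (compositions; ratioCoeff; Δ-compositions; ratioCoeff-closedForm)
  open SkewKostkaFormula d using (kostka2-formula)

  summand : ℕ → ℕ → ℤ
  summand s j = sgn j *ℤ (+ (l C j)) *ℤ (+ ((s ∸ j * (1 + d) + (l ∸ 2)) C (l ∸ 2)))

  even : (s : ℕ) → d * l ∸ i ≡ 2 * s → + K i d l ≡ Σ≤ ((d * l ∸ i) / (2 + 2 * d)) (summand s)
  even s dl∸i≡2s = begin
    + K i d l                                    ≡⟨ cong +_ (K-even i d l s i≤dl dl∸i≡2s) ⟩
    + kostka2 (s + i) s d l                      ≡⟨ kostka2-formula l (s + i) s (two-row-lengths s i≤dl dl∸i≡2s)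
                                                                                 (m≤m+n s i) ⟩
    Δ (compositions l) (+ s)                     ≡⟨ Δ-compositions (suc l′) (+ s) ⟩
    ratioCoeff l (suc l′) (+ s)                  ≡⟨ ratioCoeff-closedForm l l′ s ⟩
    Σ≤ (s / suc d) (summand s)                   ≡⟨ cong (λ n → Σ≤ n (summand s)) row-bound ⟨
    Σ≤ ((d * l ∸ i) / (2 + 2 * d)) (summand s)   ∎
    where
    row-bound : (d * l ∸ i) / (2 + 2 * d) ≡ s / suc d
    row-bound = trans (/-congˡ dl∸i≡2s) (trans (/-congʳ {m = 2 * s} (sym (*-suc 2 d))) (m*n/m*o≡n/o 2 s (suc d)))
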